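{- Let $T$ be a tournament, let $P=x_0x_1\cdots x_r$ be a directed path of length $r$ in $T$, and let $z\in V(T)\setminus V(P)$ be a vertex such that $\{x_{\alpha+1},x_{\alpha+2},\dots,x_r\}\rightarrow z\rightarrow\{x_0,x_1,\dots,x_\alpha\}$ for some $\alpha\in[2,r-3]$. Suppose that $T$ contains no $(x_0,x_r)$-path of length $r+1$ with vertex set $\{z\}\cup V(P)$. If $x_sx_t\in A(T)$ with $s\in[\alpha,r-2]$ and $t\in[s+2,r]$, and $k=\lfloor\frac{1}{2}(t-s)\rfloor$, then there is no arc from a vertex of $\{x_0,x_1,\dots,x_{\alpha-1}\}$ to a vertex of $\{x_{s+1},x_{s+2},\dots,x_{s+k}\}$.
   Context: A tournament is an oriented graph in which every pair of distinct vertices is joined by exactly one arc; $A(T)$ is its arc set. Paths are directed and simple; length is the number of arcs. For vertex sets $X,Y$, $X\rightarrow Y$ means every vertex of $X$ has an arc to every vertex of $Y$; a single vertex is identified with the singleton. $[a,b]=\{a,\dots,b\}$ for integers. -}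

module Defs where

open import Level using (Level; suc; _⊔_)
open import Data.Nat using (ℕ; _≤_; _<_; _+_)
open import Data.Fin using (Fin)
open import Data.Product using (∃; _×_)
open import Data.Sum using (_⊎_)
open import Relation.Binary.PropositionalEquality using (_≡_; _≢_)
open import Relation.Nullary using (¬_)
open import Function.Bundles using (_⇔_)

record Tournament (n : ℕ) : Set₁ where
  field
    _⇒_   : Fin n → Fin n → Set
    irrefl : ∀ u → ¬ (u ⇒ u)
    asym   : ∀ u v → u ⇒ v → ¬ (v ⇒ u)
    total  : ∀ u v → u ≢ v → (u ⇒ v) ⊎ (v ⇒ u)

-- A directed (simple) path of length r in T, given as the vertex
-- sequence p 0, p 1, ..., p r (values of p beyond index r are irrelevant).
record IsPath {n : ℕ} (T : Tournament n) (r : ℕ) (p : ℕ → Fin n) : Set where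
  open Tournament T
  field
    injective : ∀ i j → i ≤ r → j ≤ r → p i ≡ p j → i ≡ j
    arcs      : ∀ i → i < r → p i ⇒ p (Data.Nat.suc i)

OnPath : {n : ℕ} → ℕ → (ℕ → Fin n) → Fin n → Set
OnPath r p v = ∃ λ i → i ≤ r × p i ≡ v

module Submission where

-- Suppose xᵢ ⇒ xⱼ and put c = j − s − 1. If c = 0 then
--   x₀ … xᵢ xⱼ … xₜ₋₁ z xᵢ₊₁ … xₛ xₜ … x_r
-- is a forbidden path. Otherwise compare xₜ₋₁ with xₛ₊₁. If xₜ₋₁ ⇒ xₛ₊₁, then
--   x₀ … xᵢ xⱼ … xₜ₋₁ xₛ₊₁ … xⱼ₋₁ z xᵢ₊₁ … xₛ xₜ … x_r
-- is one. If xₛ₊₁ ⇒ xₜ₋₁, this chord satisfies the hypotheses on xₛxₜ with c one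
-- smaller: j ≤ s + ⌊(t − s)/2⌋ says exactly that xⱼ is no further from xₛ than from xₜ.
-- Candidate paths are built as vertex lists linked by arcs; being a permutation of
-- z ∷ V(P) gives both injectivity and the required vertex set.

open import Defs
open import Data.Nat using (ℕ; zero; suc; _≤_; _<_; _+_; _*_; _∸_; _/_; z≤n; s≤s; z<s; s<s)
open import Data.Nat.Properties
open import Data.Nat.DivMod using (m/n*n≤m)
open import Data.Fin using (Fin)
open import Data.Product using (∃; _×_; _,_)
open import Data.Sum using (_⊎_; inj₁; inj₂; [_,_]′)
open import Data.List using (List; []; _∷_; _++_; [_]; length; applyUpTo)
open import Data.List.Properties using (length-applyUpTo)
open import Data.List.Membership.Propositional using (_∈_)
open import Data.List.Membership.Propositional.Properties using (∈-applyUpTo⁺; ∈-applyUpTo⁻)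
open import Data.List.Relation.Unary.Any using (here; there)
import Data.List.Relation.Unary.All as All
import Data.List.Relation.Unary.All.Properties as All
open import Data.List.Relation.Unary.AllPairs using (_∷_)
open import Data.List.Relation.Unary.Unique.Propositional using (Unique)
import Data.List.Relation.Unary.Unique.Propositional.Properties as Unique
open import Data.List.Relation.Binary.Permutation.Propositional using (_↭_; ↭-refl; ↭-sym; ↭-trans; ↭-reflexive; ↭⇒↭ₛ)
open import Data.List.Relation.Binary.Permutation.Propositional.Properties using (↭-length; ∈-resp-↭; ++⁺ˡ; ++⁺ʳ; ++-comm; ++-commutativeMonoid)
import Data.List.Relation.Binary.Permutation.Setoid.Properties as PermutationSetoid
open import Data.Empty using (⊥-elim)
open import Function using (_∘_)
open import Function.Bundles using (_⇔_; mk⇔)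
import Function.Properties.Equivalence as ⇔
open import Relation.Binary.PropositionalEquality
  using (_≡_; _≢_; refl; sym; trans; cong; cong₂; subst; subst₂; setoid; module ≡-Reasoning)
open import Relation.Nullary using (¬_)

module _ {A : Set} where

  applyUpTo-cong : ∀ {f g : ℕ → A} n → (∀ k → f k ≡ g k) → applyUpTo f n ≡ applyUpTo g n
  applyUpTo-cong zero    f≗g = refl
  applyUpTo-cong (suc n) f≗g = cong₂ _∷_ (f≗g 0) (applyUpTo-cong n (f≗g ∘ suc))

  applyUpTo-++ : ∀ (f : ℕ → A) m n →
                 applyUpTo f (m + n) ≡ applyUpTo f m ++ applyUpTo (λ k → f (m + k)) n
  applyUpTo-++ f zero    n = refl
  applyUpTo-++ f (suc m) n = cong (f 0 ∷_) (applyUpTo-++ (f ∘ suc) m n)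

  -- f a, …, f (b ∸ 1); empty when b ≤ a.
  segment : (ℕ → A) → ℕ → ℕ → List A
  segment f a b = applyUpTo (λ k → f (a + k)) (b ∸ a)

  segment-++ : ∀ f {a b c} → a ≤ b → b ≤ c → segment f a b ++ segment f b c ≡ segment f a c
  segment-++ f {a} {b} {c} a≤b b≤c = begin
    applyUpTo g (b ∸ a) ++ applyUpTo (λ k → f (b + k)) (c ∸ b)
      ≡⟨ cong (applyUpTo g (b ∸ a) ++_) (applyUpTo-cong (c ∸ b) shift) ⟨
    applyUpTo g (b ∸ a) ++ applyUpTo (λ k → g ((b ∸ a) + k)) (c ∸ b)
      ≡⟨ applyUpTo-++ g (b ∸ a) (c ∸ b) ⟨
    applyUpTo g ((b ∸ a) + (c ∸ b))
      ≡⟨ cong (applyUpTo g) gaps ⟩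
    applyUpTo g (c ∸ a) ∎
    where
    open ≡-Reasoning
    g : ℕ → A
    g k = f (a + k)
    shift : ∀ k → g ((b ∸ a) + k) ≡ f (b + k)
    shift k = cong f (trans (sym (+-assoc a (b ∸ a) k)) (cong (_+ k) (m+[n∸m]≡n a≤b)))
    gaps : (b ∸ a) + (c ∸ b) ≡ c ∸ a
    gaps = trans (sym (+-∸-comm (c ∸ b) a≤b)) (cong (_∸ a) (m+[n∸m]≡n b≤c))

  segment-empty : ∀ f {a b} → b ≤ a → segment f a b ≡ []
  segment-empty f b≤a = cong (applyUpTo _) (m≤n⇒m∸n≡0 b≤a)

  splice-↭ : ∀ (a b c d e w : List A) → a ++ (c ++ d) ++ w ++ b ++ e ↭ w ++ a ++ b ++ c ++ d ++ e
  splice-↭ = solve 6 (λ a b c d e w → a ⊕ (c ⊕ d) ⊕ w ⊕ b ⊕ e ⊜ w ⊕ a ⊕ b ⊕ c ⊕ d ⊕ e) ↭-refl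
    where open import Algebra.Solver.CommutativeMonoid (++-commutativeMonoid {A = A})

  infixr 5 _∷_
  data Walk (R : A → A → Set) : A → A → List A → Set where
    done : ∀ u → Walk R u u [ u ]
    _∷_ : ∀ {u v w vs} → R u v → Walk R v w vs → Walk R u w (u ∷ vs)

  module _ {R : A → A → Set} where

    infixr 5 _++⟨_⟩_
    _++⟨_⟩_ : ∀ {u v v′ w vs ws} → Walk R u v vs → R v v′ → Walk R v′ w ws → Walk R u w (vs ++ ws)
    done u   ++⟨ e ⟩ q = e ∷ q
    (e′ ∷ p) ++⟨ e ⟩ q = e′ ∷ (p ++⟨ e ⟩ q)

    applyUpTo-walk : ∀ (f : ℕ → A) l → (∀ k → k < l → R (f k) (f (suc k))) →
                     Walk R (f 0) (f l) (applyUpTo f (suc l))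
    applyUpTo-walk f zero    _    = done (f 0)
    applyUpTo-walk f (suc l) arcs = arcs 0 z<s ∷ applyUpTo-walk (f ∘ suc) l (λ k k<l → arcs (suc k) (s<s k<l))

  nth : A → List A → ℕ → A
  nth d []       _       = d
  nth d (v ∷ vs) zero    = v
  nth d (v ∷ vs) (suc m) = nth d vs m

  nth-∈ : ∀ d vs {m} → m < length vs → nth d vs m ∈ vs
  nth-∈ d (v ∷ vs) {zero}  _         = here refl
  nth-∈ d (v ∷ vs) {suc m} (s<s m<l) = there (nth-∈ d vs m<l)

  ∈⇒nth : ∀ d {vs v} → v ∈ vs → ∃ λ m → m < length vs × nth d vs m ≡ v
  ∈⇒nth d (here v≡u) = 0 , z<s , sym v≡u
  ∈⇒nth d (there v∈vs) with m , m<l , eq ← ∈⇒nth d v∈vs = suc m , s<s m<l , eq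

  nth-injective : ∀ d {vs} → Unique vs → ∀ {m m′} → m < length vs → m′ < length vs →
                  nth d vs m ≡ nth d vs m′ → m ≡ m′
  nth-injective d {v ∷ vs} (v∉vs ∷ uniq) {zero}  {zero}   _         _          _  = refl
  nth-injective d {v ∷ vs} (v∉vs ∷ uniq) {zero}  {suc m′} _         (s<s m′<l) eq =
    ⊥-elim (All.lookup v∉vs (nth-∈ d vs m′<l) eq)
  nth-injective d {v ∷ vs} (v∉vs ∷ uniq) {suc m} {zero}   (s<s m<l) _          eq =
    ⊥-elim (All.lookup v∉vs (nth-∈ d vs m<l) (sym eq))
  nth-injective d {v ∷ vs} (v∉vs ∷ uniq) {suc m} {suc m′} (s<s m<l) (s<s m′<l) eq =
    cong suc (nth-injective d uniq m<l m′<l eq)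

  module _ {R : A → A → Set} (d : A) where

    walk-head : ∀ {u w vs} → Walk R u w vs → nth d vs 0 ≡ u
    walk-head (done u) = refl
    walk-head (e ∷ p)  = refl

    walk-last : ∀ {u w vs} → Walk R u w vs → nth d vs (length vs ∸ 1) ≡ w
    walk-last (done u)        = refl
    walk-last (e ∷ done v)    = refl
    walk-last (e ∷ p@(_ ∷ _)) = walk-last p

    walk-arc : ∀ {u w vs m} → Walk R u w vs → suc m < length vs → R (nth d vs m) (nth d vs (suc m))
    walk-arc             (done u) (s<s ())
    walk-arc {m = zero}  (e ∷ p)  _         = subst (R _) (sym (walk-head p)) e
    walk-arc {m = suc m} (e ∷ p)  (s<s m<l) = walk-arc p m<l

module _ {n} (T : Tournament n) where
  open Tournament T

  walk⇒path : ∀ {u w vs l} → Walk _⇒_ u w vs → length vs ≡ suc l → Unique vs →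
              ∃ λ (y : ℕ → Fin n) → IsPath T l y × y 0 ≡ u × y l ≡ w × (∀ v → OnPath l y v ⇔ v ∈ vs)
  walk⇒path {u} {w} {vs} {l} p len uniq = y , path , walk-head u p , ends-at-w , vertices
    where
    y : ℕ → Fin n
    y = nth u vs
    in-range : ∀ {m} → m ≤ l → m < length vs
    in-range m≤l = subst (_ <_) (sym len) (s≤s m≤l)
    path : IsPath T l y
    path = record
      { injective = λ i j i≤l j≤l → nth-injective u uniq (in-range i≤l) (in-range j≤l)
      ; arcs      = λ i i<l → walk-arc u p (in-range i<l) }
    ends-at-w : y l ≡ w
    ends-at-w = trans (cong (y ∘ (_∸ 1)) (sym len)) (walk-last u p)
    vertices : ∀ v → OnPath l y v ⇔ v ∈ vs
    vertices v = mk⇔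
      (λ (m , m≤l , ym≡v) → subst (_∈ vs) ym≡v (nth-∈ u vs (in-range m≤l)))
      (λ v∈vs → let (m , m<len , ym≡v) = ∈⇒nth u v∈vs in m , ≤-pred (subst (m <_) len m<len) , ym≡v)

module Rerouting {n} (T : Tournament n) (r : ℕ) (x : ℕ → Fin n) (z : Fin n)
                 (P : IsPath T r x) (z∉P : ∀ i → i ≤ r → x i ≢ z) where
  open Tournament T

  Extension : Set
  Extension = ∃ λ (y : ℕ → Fin n) → IsPath T (r + 1) y × y 0 ≡ x 0 × y (r + 1) ≡ x r ×
              (∀ v → OnPath (r + 1) y v ⇔ (v ≡ z ⊎ OnPath r x v))

  vertices : List (Fin n)
  vertices = segment x 0 (suc r)

  ∈-z∷vertices : ∀ {v} → v ∈ z ∷ vertices ⇔ (v ≡ z ⊎ OnPath r x v)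
  ∈-z∷vertices = mk⇔ to from
    where
    to : ∀ {v} → v ∈ z ∷ vertices → v ≡ z ⊎ OnPath r x v
    to (here v≡z) = inj₁ v≡z
    to (there v∈P) with i , i<r , v≡xi ← ∈-applyUpTo⁻ x v∈P = inj₂ (i , ≤-pred i<r , sym v≡xi)
    from : ∀ {v} → v ≡ z ⊎ OnPath r x v → v ∈ z ∷ vertices
    from (inj₁ v≡z)              = here v≡z
    from (inj₂ (i , i≤r , xi≡v)) = there (subst (_∈ vertices) xi≡v (∈-applyUpTo⁺ x (s≤s i≤r)))

  z∷vertices-unique : Unique (z ∷ vertices)
  z∷vertices-unique =
    All.applyUpTo⁺₁ x (suc r) (λ i<r z≡xi → z∉P _ (≤-pred i<r) (sym z≡xi)) ∷
    Unique.applyUpTo⁺₁ x (suc r) (λ i<j j<r xi≡xj →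
      <⇒≢ i<j (IsPath.injective P _ _ (≤-pred (<-trans i<j j<r)) (≤-pred j<r) xi≡xj))

  extension-from-walk : ∀ {vs} → Walk _⇒_ (x 0) (x r) vs → vs ↭ z ∷ vertices → Extension
  extension-from-walk {vs} p vs↭ =
    let y , path , start , end , on-y = walk⇒path T p length-vs unique-vs
    in  y , path , start , end , λ v → ⇔.trans (on-y v) (⇔.trans ∈-vs ∈-z∷vertices)
    where
    length-vs : length vs ≡ suc (r + 1)
    length-vs = trans (↭-length vs↭) (cong suc (trans (length-applyUpTo x (suc r)) (+-comm 1 r)))
    unique-vs : Unique vs
    unique-vs = PermutationSetoid.Unique-resp-↭ (setoid (Fin n)) (↭⇒↭ₛ (↭-sym vs↭)) z∷vertices-unique
    ∈-vs : ∀ {v} → v ∈ vs ⇔ v ∈ z ∷ vertices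
    ∈-vs = mk⇔ (∈-resp-↭ vs↭) (∈-resp-↭ (↭-sym vs↭))

  segment-walk : ∀ {a b} → a ≤ b → b ≤ r → Walk _⇒_ (x a) (x b) (segment x a (suc b))
  segment-walk {a} {b} a≤b b≤r =
    subst₂ (λ u w → Walk _⇒_ u w (segment x a (suc b)))
           (cong x (+-identityʳ a)) (cong x (m+[n∸m]≡n a≤b)) walk
    where
    arc : ∀ k → k < b ∸ a → x (a + k) ⇒ x (a + suc k)
    arc k k<b∸a = subst (λ l → x (a + k) ⇒ x l) (sym (+-suc a k)) (IsPath.arcs P (a + k) a+k<r)
      where
      a+k<r : a + k < r
      a+k<r = <-≤-trans (subst (a + k <_) (m+[n∸m]≡n a≤b) (+-monoʳ-< a k<b∸a)) b≤r
    walk : Walk _⇒_ (x (a + 0)) (x (a + (b ∸ a))) (segment x a (suc b))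
    walk rewrite +-∸-assoc 1 a≤b = applyUpTo-walk (λ k → x (a + k)) (b ∸ a) arc

  -- The route x₀ … xᵢ ⇒ xⱼ ⋯ xₘ ⇒ z ⇒ xᵢ₊₁ … xₛ ⇒ xₜ … x_r, where the middle walk covers x_{s+1} … x_{t−1}.
  reroute : ∀ {i s j t m ws} → i < s → s < j → j ≤ t → t ≤ r →
            x i ⇒ x j → z ⇒ x (suc i) → x s ⇒ x t → x m ⇒ z →
            Walk _⇒_ (x j) (x m) ws → ws ↭ segment x (suc s) j ++ segment x j t → Extension
  reroute {i} {s} {j} {t} {m} {ws} i<s s<j j≤t t≤r i⇒j z⇒ s⇒t m⇒z middle middle↭ =
    extension-from-walk
      (segment-walk z≤n i≤r ++⟨ i⇒j ⟩ middle ++⟨ m⇒z ⟩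
       z⇒ ∷ segment-walk i<s s≤r ++⟨ s⇒t ⟩ segment-walk t≤r ≤-refl)
      (↭-trans (++⁺ˡ A (++⁺ʳ _ middle↭))
        (↭-trans (splice-↭ A B C D E [ z ]) (↭-reflexive (cong (z ∷_) pieces))))
    where
    s≤r : s ≤ r
    s≤r = <⇒≤ (<-≤-trans s<j (≤-trans j≤t t≤r))
    i≤r : i ≤ r
    i≤r = <⇒≤ (<-≤-trans i<s s≤r)
    A B C D E : List (Fin n)
    A = segment x 0 (suc i)
    B = segment x (suc i) (suc s)
    C = segment x (suc s) j
    D = segment x j t
    E = segment x t (suc r)
    pieces : A ++ B ++ C ++ D ++ E ≡ vertices
    pieces = begin
      A ++ B ++ C ++ D ++ E
        ≡⟨ cong (λ l → A ++ B ++ C ++ l) (segment-++ x j≤t (m≤n⇒m≤1+n t≤r)) ⟩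
      A ++ B ++ C ++ segment x j (suc r)
        ≡⟨ cong (λ l → A ++ B ++ l) (segment-++ x s<j (m≤n⇒m≤1+n (≤-trans j≤t t≤r))) ⟩
      A ++ B ++ segment x (suc s) (suc r)
        ≡⟨ cong (A ++_) (segment-++ x (s≤s (<⇒≤ i<s)) (s≤s s≤r)) ⟩
      A ++ segment x (suc i) (suc r)
        ≡⟨ segment-++ x z≤n (s≤s i≤r) ⟩
      vertices ∎
      where open ≡-Reasoning

  module _ {i j α} (i⇒j : x i ⇒ x j) (z⇒ : z ⇒ x (suc i)) (⇒z : ∀ m → α < m → m ≤ r → x m ⇒ z) where

    rotate : ∀ c {s t} → suc c + s ≡ j → c + j < t → t ≤ r → i < s → α ≤ s → x s ⇒ x t → Extension
    rotate zero {s} {suc t} 1+s≡j j<1+t 1+t≤r i<s α≤s s⇒1+t =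
      reroute i<s s<j (m≤n⇒m≤1+n j≤t) 1+t≤r i⇒j z⇒ s⇒1+t (⇒z t α<t t≤r) (segment-walk j≤t t≤r)
        (↭-reflexive (cong (_++ segment x j (suc t)) (sym (segment-empty x (≤-reflexive (sym 1+s≡j))))))
      where
      s<j : s < j
      s<j = ≤-reflexive 1+s≡j
      j≤t : j ≤ t
      j≤t = ≤-pred j<1+t
      t≤r : t ≤ r
      t≤r = <⇒≤ 1+t≤r
      α<t : α < t
      α<t = <-≤-trans (≤-<-trans α≤s s<j) j≤t
    rotate (suc c) {s} {suc t} 2+c+s≡j 1+c+j<1+t 1+t≤r i<s α≤s s⇒1+t =
      [ close , recurse ]′ (total (x t) (x (suc s)) xt≢x1+s)
      where
      1+s<j : suc s < j
      1+s<j = subst (suc s <_) 2+c+s≡j (s≤s (s≤s (m≤n+m s c)))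
      j≤t : j ≤ t
      j≤t = ≤-trans (m≤n+m j (suc c)) (≤-pred 1+c+j<1+t)
      t≤r : t ≤ r
      t≤r = <⇒≤ 1+t≤r
      j-1≤r : suc c + s ≤ r
      j-1≤r = <⇒≤ (≤-trans (≤-reflexive 2+c+s≡j) (≤-trans j≤t t≤r))
      xt≢x1+s : x t ≢ x (suc s)
      xt≢x1+s xt≡x1+s = <⇒≢ (<-≤-trans 1+s<j j≤t)
        (sym (IsPath.injective P t (suc s) t≤r (≤-trans (<⇒≤ 1+s<j) (≤-trans j≤t t≤r)) xt≡x1+s))
      C-walk : Walk _⇒_ (x (suc s)) (x (suc c + s)) (segment x (suc s) j)
      C-walk = subst (Walk _⇒_ (x (suc s)) (x (suc c + s))) (cong (segment x (suc s)) 2+c+s≡j)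
                     (segment-walk (s≤s (m≤n+m s c)) j-1≤r)
      close : x t ⇒ x (suc s) → Extension
      close t⇒1+s = reroute i<s (<-trans (n<1+n s) 1+s<j) (m≤n⇒m≤1+n j≤t) 1+t≤r i⇒j z⇒ s⇒1+t
        (⇒z (suc c + s) (s≤s (≤-trans α≤s (m≤n+m s c))) j-1≤r)
        (segment-walk j≤t t≤r ++⟨ t⇒1+s ⟩ C-walk)
        (++-comm (segment x j (suc t)) (segment x (suc s) j))
      recurse : x (suc s) ⇒ x t → Extension
      recurse 1+s⇒t = rotate c (trans (cong suc (+-suc c s)) 2+c+s≡j) (≤-pred 1+c+j<1+t) t≤r
                             (m<n⇒m<1+n i<s) (m≤n⇒m≤1+n α≤s) 1+s⇒t

half-gap-bound : ∀ {s c j t} → suc c + s ≡ j → s ≤ t → j ≤ s + (t ∸ s) / 2 → c + j < t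
half-gap-bound {s} {c} {j} {t} 1+c+s≡j s≤t j≤s+half = begin-strict
  c + j                 ≡⟨ cong (c +_) 1+c+s≡j ⟨
  c + (suc c + s)       <⟨ n<1+n _ ⟩
  suc (c + (suc c + s)) ≡⟨ twice c s ⟩
  s + suc c * 2         ≤⟨ +-monoʳ-≤ s (*-monoˡ-≤ 2 1+c≤half) ⟩
  s + (t ∸ s) / 2 * 2   ≤⟨ +-monoʳ-≤ s (m/n*n≤m (t ∸ s) 2) ⟩
  s + (t ∸ s)           ≡⟨ m+[n∸m]≡n s≤t ⟩
  t                     ∎
  where
  open ≤-Reasoning
  twice : ∀ c s → suc (c + (suc c + s)) ≡ s + suc c * 2
  twice = solve-∀
    where open import Data.Nat.Tactic.RingSolver using (solve-∀)
  1+c≤half : suc c ≤ (t ∸ s) / 2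
  1+c≤half = +-cancelˡ-≤ s (suc c) _
               (≤-trans (≤-reflexive (trans (+-comm s (suc c)) 1+c+s≡j)) j≤s+half)

lemma3p4 : {n : ℕ} (T : Tournament n) (r : ℕ) (x : ℕ → Fin n) (z : Fin n) (α s t : ℕ) →
    IsPath T r x →
    (∀ i → i ≤ r → x i ≢ z) →
    2 ≤ α → α + 3 ≤ r →
    (∀ i → α < i → i ≤ r → Tournament._⇒_ T (x i) z) →
    (∀ i → i ≤ α → Tournament._⇒_ T z (x i)) →
    (¬ (∃ λ (y : ℕ → Fin n) → IsPath T (r + 1) y × y 0 ≡ x 0 × y (r + 1) ≡ x r ×
         (∀ v → OnPath (r + 1) y v ⇔ (v ≡ z ⊎ OnPath r x v)))) →
    Tournament._⇒_ T (x s) (x t) →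
    α ≤ s → s + 2 ≤ r → s + 2 ≤ t → t ≤ r →
    ∀ i j → i < α → s < j → j ≤ s + (t ∸ s) / 2 →
    ¬ (Tournament._⇒_ T (x i) (x j))
lemma3p4 T r x z α s t P z∉P _ _ ⇒z z⇒ no-extension s⇒t α≤s _ s+2≤t t≤r i j i<α s<j j≤s+half i⇒j =
  no-extension (rotate i⇒j (z⇒ (suc i) i<α) ⇒z c 1+c+s≡j (half-gap-bound 1+c+s≡j s≤t j≤s+half)
                       t≤r (<-≤-trans i<α α≤s) α≤s s⇒t)
  where
  open Rerouting T r x z P z∉P
  c : ℕ
  c = j ∸ suc s
  1+c+s≡j : suc c + s ≡ j
  1+c+s≡j = trans (sym (+-suc c s)) (m∸n+n≡m s<j)
  s≤t : s ≤ t
  s≤t = ≤-trans (m≤m+n s 2) s+2≤t
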